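{- Suppose that $n$ is divisible by $4$. Then, letting $P_3$ denote the path with $3$ edges, \[ \mathrm{ex}^*(n,P_3)=\frac{3n}{2}=\frac32\,\mathrm{ex}(n,P_3)+O(1). \]
   Context: $\mathrm{ex}(n,F)$ is the usual Turán number: the maximum number of edges in an $n$-vertex graph containing no copy of $F$. $\mathrm{ex}^*(n,F)$ (the rainbow Turán number) is the maximum number of edges in an $n$-vertex graph that admits a proper edge-coloring containing no rainbow copy of $F$, i.e. no copy of $F$ all of whose edges receive different colors. -}

module Defs where

open import Data.Nat using (ℕ; _+_; _*_; _≤_; _<ᵇ_)
open import Data.Bool using (Bool; true; false; _∧_; if_then_else_)
open import Data.Fin using (Fin; toℕ)
open import Data.List using (List; map; allFin)
open import Data.Nat.ListAction using (sum)
open import Data.Product using (Σ; _×_; ∃)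
open import Relation.Binary.PropositionalEquality using (_≡_; _≢_)

record Graph (n : ℕ) : Set where
  field
    adj    : Fin n → Fin n → Bool
    sym    : ∀ i j → adj i j ≡ adj j i
    irrefl : ∀ i → adj i i ≡ false
open Graph public

Adj : ∀ {n} → Graph n → Fin n → Fin n → Set
Adj G i j = adj G i j ≡ true

edgeCount : ∀ {n} → Graph n → ℕ
edgeCount {n} G =
  sum (map (λ i → sum (map (λ j → if (toℕ i <ᵇ toℕ j) ∧ adj G i j then 1 else 0)
                            (allFin n)))
           (allFin n))

-- A (not necessarily induced) copy of P₃ (path with 3 edges) a-b-c-d:
-- four pairwise distinct vertices with edges ab, bc, cd.
IsP3 : ∀ {n} → Graph n → Fin n → Fin n → Fin n → Fin n → Set
IsP3 G a b c d =
  a ≢ b × a ≢ c × a ≢ d × b ≢ c × b ≢ d × c ≢ d ×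
  Adj G a b × Adj G b c × Adj G c d

ContainsP3 : ∀ {n} → Graph n → Set
ContainsP3 {n} G = Σ (Fin n) λ a → Σ (Fin n) λ b → Σ (Fin n) λ c → Σ (Fin n) λ d →
  IsP3 G a b c d

P3Free : ∀ {n} → Graph n → Set
P3Free G = ContainsP3 G → Data.Empty.⊥
  where import Data.Empty

-- An edge-colouring (colours in ℕ); only values on edges matter.
Colouring : ℕ → Set
Colouring n = Fin n → Fin n → ℕ

IsProper : ∀ {n} → Graph n → Colouring n → Set
IsProper {n} G col =
  (∀ u v → Adj G u v → col u v ≡ col v u) ×
  (∀ u v w → Adj G u v → Adj G u w → v ≢ w → col u v ≢ col u w)

ContainsRainbowP3 : ∀ {n} → Graph n → Colouring n → Set
ContainsRainbowP3 {n} G col =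
  Σ (Fin n) λ a → Σ (Fin n) λ b → Σ (Fin n) λ c → Σ (Fin n) λ d →
    IsP3 G a b c d ×
    col a b ≢ col b c × col a b ≢ col c d × col b c ≢ col c d

RainbowP3Free : ∀ {n} → Graph n → Set
RainbowP3Free {n} G = Σ (Colouring n) λ col →
  IsProper G col × (ContainsRainbowP3 G col → Data.Empty.⊥)
  where import Data.Empty

IsMaxEdges : (∀ {n} → Graph n → Set) → ℕ → ℕ → Set
IsMaxEdges P n m =
  (Σ (Graph n) λ G → P G × edgeCount G ≡ m) ×
  (∀ (G : Graph n) → P G → edgeCount G ≤ m)

IsEx : ℕ → ℕ → Set
IsEx n m = IsMaxEdges P3Free n m

IsExStar : ℕ → ℕ → Set
IsExStar n m = IsMaxEdges RainbowP3Free n m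

-- Both bounds come from one counting argument: if every vertex of degree > t has only leaves
-- as neighbours, charge each edge at a high-degree vertex to its leaf end; then every vertex
-- carries a load of at most t, so 2e ≤ tn.  A P₃-free graph has this property for t = 2.  A
-- properly coloured graph without rainbow P₃ has it for t = 3: if b has degree ≥ 4 and a
-- neighbour c with a further neighbour d, every neighbour a ∉ {c, d} of b must give ab the
-- colour of cd (else a-b-c-d is rainbow), and two such neighbours clash at b.
-- The value 3n/2 is attained by n/4 disjoint copies of K₄ coloured by the Klein four-group
-- (ab gets colour a ⊕ b): a P₃ inside a K₄ uses all four vertices, so a ⊕ b = c ⊕ d.
-- For ex(n, P₃) the star gives e ≥ n − 1 against e ≤ n.
module Submission where

open import Defs hiding (sym; irrefl)
open import Data.Nat using (ℕ; zero; suc; _+_; _*_; _≤_; _<_; _<ᵇ_; _/_; _≤?_; z≤n; s≤s; s≤s⁻¹; z<s)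
  renaming (_≟_ to _≟ℕ_)
open import Data.Nat.Properties hiding (suc-injective; _≟_)
open import Data.Nat.Divisibility using (_∣_; divides)
open import Data.Nat.DivMod using (m*n/n≡m)
open import Data.Nat.ListAction as List using ()
open import Data.Bool using (Bool; true; false; _∧_; not; _xor_; if_then_else_; T)
open import Data.Bool.Properties using (∧-zeroʳ; xor-comm; xor-same)
open import Data.Fin using (Fin; zero; suc; toℕ; _≟_; punchIn; punchOut; combine; remQuot)
open import Data.Fin.Patterns using (0F; 1F; 2F; 3F)
open import Data.Fin.Properties
  using (toℕ-injective; all?; suc-injective; punchIn-injective; punchInᵢ≢i;
         punchOut-injective; punchIn-punchOut; remQuot-combine; combine-remQuot;
         combine-injectiveʳ)
open import Data.List using (List; []; _∷_; length; map; allFin; tabulate)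
open import Data.List.Properties using (map-tabulate)
open import Data.List.Relation.Unary.All using (All; []; _∷_)
open import Data.Product using (Σ; ∃; _×_; _,_; proj₁; proj₂)
open import Data.Empty using (⊥)
open import Function using (_∘_; id)
open import Function.Definitions using (Injective)
open import Relation.Nullary using (yes; no; does; contradiction)
open import Relation.Nullary.Reflects using (ofʸ; ofⁿ)
open import Relation.Nullary.Decidable using (dec-true; dec-false; from-yes; ¬?; _→-dec_)
open import Relation.Binary.PropositionalEquality
open import Algebra.Properties.CommutativeMonoid.Sum +-0-commutativeMonoid
  using (sum; sum-cong-≗; sum-remove; sum-replicate-zero; ∑-distrib-+; ∑-comm)

sum-tabulate : ∀ {n} (f : Fin n → ℕ) → List.sum (tabulate f) ≡ sum f
sum-tabulate {zero}  f = refl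
sum-tabulate {suc n} f = cong (f zero +_) (sum-tabulate (f ∘ suc))

sum-map-allFin : ∀ {n} (f : Fin n → ℕ) → List.sum (map f (allFin n)) ≡ sum f
sum-map-allFin f = trans (cong List.sum (map-tabulate id f)) (sum-tabulate f)

sum-mono-≤ : ∀ {n} {f g : Fin n → ℕ} → (∀ i → f i ≤ g i) → sum f ≤ sum g
sum-mono-≤ {zero}  _   = z≤n
sum-mono-≤ {suc n} f≤g = +-mono-≤ (f≤g zero) (sum-mono-≤ (f≤g ∘ suc))

sum-≤-* : ∀ {n} t {f : Fin n → ℕ} → (∀ i → f i ≤ t) → sum f ≤ n * t
sum-≤-* {zero}  t _   = z≤n
sum-≤-* {suc n} t f≤t = +-mono-≤ (f≤t zero) (sum-≤-* t (f≤t ∘ suc))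

*-≤-sum : ∀ {n} t {f : Fin n → ℕ} → (∀ i → t ≤ f i) → n * t ≤ sum f
*-≤-sum {zero}  t _   = z≤n
*-≤-sum {suc n} t t≤f = +-mono-≤ (t≤f zero) (*-≤-sum t (t≤f ∘ suc))

sum-positive : ∀ {n} (f : Fin n → ℕ) → 0 < sum f → ∃ λ i → 0 < f i
sum-positive {suc n} f 0<Σ with f zero in eq
... | suc _ = zero , subst (0 <_) (sym eq) z<s
... | zero with i , 0<fi ← sum-positive (f ∘ suc) 0<Σ = suc i , 0<fi

sum-≤-+-at : ∀ {n} (x : Fin n) {f g : Fin n → ℕ} →
             (∀ y → y ≢ x → f y ≤ g y) → sum f ≤ f x + sum g
sum-≤-+-at zero {f} {g} f≤g =
  +-monoʳ-≤ (f zero) (≤-trans (sum-mono-≤ (λ i → f≤g (suc i) λ ())) (m≤n+m _ (g zero)))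
sum-≤-+-at (suc x) {f} {g} f≤g = begin
  f zero + sum (f ∘ suc)               ≤⟨ +-mono-≤ (f≤g zero λ ()) (sum-≤-+-at x (λ y y≢x → f≤g (suc y) (y≢x ∘ suc-injective))) ⟩
  g zero + (f (suc x) + sum (g ∘ suc)) ≡⟨ +-comm (g zero) _ ⟩
  f (suc x) + sum (g ∘ suc) + g zero   ≡⟨ +-assoc (f (suc x)) _ _ ⟩
  f (suc x) + (sum (g ∘ suc) + g zero) ≡⟨ cong (f (suc x) +_) (+-comm _ (g zero)) ⟩
  f (suc x) + sum g                    ∎
  where open ≤-Reasoning

zeroAt : ∀ {n} → Fin n → (Fin n → ℕ) → Fin n → ℕ
zeroAt x f y = if does (y ≟ x) then 0 else f y

zeroAt-≤ : ∀ {n} (x : Fin n) f y → zeroAt x f y ≤ f y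
zeroAt-≤ x f y with y ≟ x
... | yes _ = z≤n
... | no  _ = ≤-refl

≤-zeroAt : ∀ {n} (x : Fin n) f y → y ≢ x → f y ≤ zeroAt x f y
≤-zeroAt x f y y≢x with y ≟ x
... | yes y≡x = contradiction y≡x y≢x
... | no  _   = ≤-refl

zeroAt-positive : ∀ {n} (x : Fin n) f y → 0 < zeroAt x f y → y ≢ x
zeroAt-positive x f y _ with y ≟ x
... | no y≢x = y≢x

sum-≤-suc-zeroAt : ∀ {n} (x : Fin n) f → f x ≤ 1 → sum f ≤ suc (sum (zeroAt x f))
sum-≤-suc-zeroAt x f fx≤1 = ≤-trans (sum-≤-+-at x (≤-zeroAt x f)) (+-monoˡ-≤ _ fx≤1)

positive-outside : ∀ {n} (L : List (Fin n)) (f : Fin n → ℕ) → (∀ i → f i ≤ 1) →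
                   length L < sum f → ∃ λ y → 0 < f y × All (y ≢_) L
positive-outside [] f _ 0<Σ with y , 0<fy ← sum-positive f 0<Σ = y , 0<fy , []
positive-outside (x ∷ L) f f≤1 |L|<Σ
  with y , 0<f₀y , y∉L ← positive-outside L (zeroAt x f) (λ i → ≤-trans (zeroAt-≤ x f i) (f≤1 i))
                           (s≤s⁻¹ (<-≤-trans |L|<Σ (sum-≤-suc-zeroAt x f (f≤1 x))))
  = y , ≤-trans 0<f₀y (zeroAt-≤ x f y) , zeroAt-positive x f y 0<f₀y ∷ y∉L

injection-≤-sum : ∀ {m n} (f : Fin n → ℕ) (g : Fin m → Fin n) → Injective _≡_ _≡_ g →
                  (∀ s → 0 < f (g s)) → m ≤ sum f
injection-≤-sum {zero}          f g _   _   = z≤n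
injection-≤-sum {suc m} {zero}  f g _   _   with () ← g zero
injection-≤-sum {suc m} {suc n} f g inj pos = begin
  suc m                                  ≤⟨ +-mono-≤ (pos zero) (injection-≤-sum (f ∘ punchIn (g zero)) g′ g′-injective g′-pos) ⟩
  f (g zero) + sum (f ∘ punchIn (g zero)) ≡⟨ sum-remove f ⟨
  sum f                                  ∎
  where
  open ≤-Reasoning
  g₀≢g : ∀ s → g zero ≢ g (suc s)
  g₀≢g s eq with () ← inj eq
  g′ : Fin m → Fin n
  g′ s = punchOut (g₀≢g s)
  g′-injective : Injective _≡_ _≡_ g′
  g′-injective eq = suc-injective (inj (punchOut-injective (g₀≢g _) (g₀≢g _) eq))
  g′-pos : ∀ s → 0 < f (punchIn (g zero) (g′ s))
  g′-pos s rewrite punchIn-punchOut (g₀≢g s) = pos (suc s)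

bit : Bool → ℕ
bit b = if b then 1 else 0

bit-positive : ∀ {b} → 0 < bit b → b ≡ true
bit-positive {true} _ = refl

bit-≤-1 : ∀ b → bit b ≤ 1
bit-≤-1 true  = ≤-refl
bit-≤-1 false = z≤n

module _ {n} (G : Graph n) where

  deg : Fin n → ℕ
  deg v = sum λ u → bit (adj G v u)

  Adj-sym : ∀ {u v} → Adj G u v → Adj G v u
  Adj-sym {u} {v} uv = trans (Graph.sym G v u) uv

  Adj⇒≢ : ∀ {u v} → Adj G u v → u ≢ v
  Adj⇒≢ {u} uu refl with () ← trans (sym (Graph.irrefl G u)) uu

  neighbour-outside : ∀ v (L : List (Fin n)) → length L < deg v →
                      ∃ λ y → Adj G v y × All (y ≢_) L
  neighbour-outside v L |L|<deg
    with y , 0<bit , y∉L ← positive-outside L (bit ∘ adj G v) (bit-≤-1 ∘ adj G v) |L|<deg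
    = y , bit-positive 0<bit , y∉L

  private
    forward : Fin n → Fin n → ℕ
    forward i j = bit ((toℕ i <ᵇ toℕ j) ∧ adj G i j)

  edgeCount-sum : edgeCount G ≡ sum λ i → sum λ j → forward i j
  edgeCount-sum =
    trans (sum-map-allFin (λ i → List.sum (map (forward i) (allFin n)))) (sum-cong-≗ λ i → sum-map-allFin (forward i))

  bit-adj-forward : ∀ i j → bit (adj G i j) ≡ forward i j + forward j i
  bit-adj-forward i j
    with toℕ i <ᵇ toℕ j | <ᵇ-reflects-< (toℕ i) (toℕ j)
       | toℕ j <ᵇ toℕ i | <ᵇ-reflects-< (toℕ j) (toℕ i)
  ... | true  | ofʸ i<j   | true  | ofʸ j<i   = contradiction i<j (<-asym j<i)
  ... | true  | _         | false | _         = sym (+-identityʳ _)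
  ... | false | _         | true  | _         = cong bit (Graph.sym G i j)
  ... | false | ofⁿ i≮j   | false | ofⁿ j≮i
    with refl ← toℕ-injective (≤-antisym (≮⇒≥ j≮i) (≮⇒≥ i≮j)) = cong bit (Graph.irrefl G i)

  handshake : sum deg ≡ 2 * edgeCount G
  handshake = begin
    sum deg                                          ≡⟨ sum-cong-≗ (λ i → sum-cong-≗ (bit-adj-forward i)) ⟩
    sum (λ i → sum λ j → forward i j + forward j i)  ≡⟨ sum-cong-≗ (λ i → ∑-distrib-+ (forward i) _) ⟩
    sum (λ i → sum (forward i) + sum λ j → forward j i) ≡⟨ ∑-distrib-+ (λ i → sum (forward i)) (λ i → sum λ j → forward j i) ⟩
    ∑∑forward + sum (λ i → sum λ j → forward j i)    ≡⟨ cong (∑∑forward +_) (∑-comm (λ i j → forward j i)) ⟩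
    ∑∑forward + ∑∑forward                            ≡⟨ cong (λ e → e + e) edgeCount-sum ⟨
    edgeCount G + edgeCount G                        ≡⟨ cong (edgeCount G +_) (+-identityʳ _) ⟨
    2 * edgeCount G                                  ∎
    where
    open ≡-Reasoning
    ∑∑forward : ℕ
    ∑∑forward = sum λ i → sum λ j → forward i j

-- The charging bound

LeafNeighboursAbove : ℕ → ∀ {n} → Graph n → Set
LeafNeighboursAbove t G = ∀ v u → Adj G v u → t < deg G v → deg G u ≤ 1

gate : Bool → ℕ → ℕ
gate b m = if b then m else 0

gate-split : ∀ b m → m ≡ gate (not b) m + gate b m
gate-split true  m = refl
gate-split false m = sym (+-identityʳ m)

gate-sum : ∀ {n} b (f : Fin n → ℕ) → gate b (sum f) ≡ sum (gate b ∘ f)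
gate-sum true  f = refl
gate-sum {n} false f = sym (sum-replicate-zero n)

gate-≤ : ∀ b m → gate b m ≤ m
gate-≤ true  m = ≤-refl
gate-≤ false m = z≤n

gate-positive : ∀ b m → 0 < gate b m → b ≡ true × 0 < m
gate-positive true m 0<m = refl , 0<m

gate-not-<ᵇ : ∀ t d → gate (not (t <ᵇ d)) d ≤ t
gate-not-<ᵇ t d with t <ᵇ d | <ᵇ-reflects-< t d
... | true  | _       = z≤n
... | false | ofⁿ t≮d = ≮⇒≥ t≮d

module _ {n} (G : Graph n) (t : ℕ) where

  private
    high : Fin n → Bool
    high v = t <ᵇ deg G v

    lowDeg highDeg highNeighbours load : Fin n → ℕ
    lowDeg v = gate (not (high v)) (deg G v)
    highDeg v = gate (high v) (deg G v)
    highNeighbours v = sum λ u → gate (high u) (bit (adj G v u))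
    load v = lowDeg v + highNeighbours v

  sum-deg≡sum-load : sum (deg G) ≡ sum load
  sum-deg≡sum-load = begin
    sum (deg G)                            ≡⟨ sum-cong-≗ (λ v → gate-split (high v) (deg G v)) ⟩
    sum (λ v → lowDeg v + highDeg v)       ≡⟨ ∑-distrib-+ lowDeg highDeg ⟩
    sum lowDeg + sum highDeg               ≡⟨ cong (sum lowDeg +_) charge-to-neighbours ⟩
    sum lowDeg + sum highNeighbours        ≡⟨ ∑-distrib-+ lowDeg highNeighbours ⟨
    sum load                               ∎
    where
    open ≡-Reasoning
    charge-to-neighbours : sum highDeg ≡ sum highNeighbours
    charge-to-neighbours = begin
      sum highDeg                                           ≡⟨ sum-cong-≗ (λ v → gate-sum (high v) (bit ∘ adj G v)) ⟩
      sum (λ v → sum λ u → gate (high v) (bit (adj G v u))) ≡⟨ ∑-comm (λ v u → gate (high v) (bit (adj G v u))) ⟩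
      sum (λ u → sum λ v → gate (high v) (bit (adj G v u))) ≡⟨ sum-cong-≗ (λ u → sum-cong-≗ λ v → cong (gate (high v) ∘ bit) (Graph.sym G v u)) ⟩
      sum highNeighbours                                    ∎

  load-≤ : 2 ≤ t → LeafNeighboursAbove t G → ∀ v → load v ≤ t
  load-≤ 2≤t leafy v with highNeighbours v ≟ℕ 0
  ... | yes none = begin
    lowDeg v + highNeighbours v ≡⟨ cong (lowDeg v +_) none ⟩
    lowDeg v + 0                ≡⟨ +-identityʳ (lowDeg v) ⟩
    lowDeg v                    ≤⟨ gate-not-<ᵇ t (deg G v) ⟩
    t                           ∎
    where open ≤-Reasoning
  ... | no some
    with u , 0<gate ← sum-positive _ (n≢0⇒n>0 some)
    with high-u , 0<bit ← gate-positive (high u) _ 0<gate = begin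
    lowDeg v + highNeighbours v ≤⟨ +-mono-≤ (gate-≤ (not (high v)) (deg G v)) (sum-mono-≤ λ w → gate-≤ (high w) (bit (adj G v w))) ⟩
    deg G v + deg G v           ≤⟨ +-mono-≤ leaf leaf ⟩
    2                           ≤⟨ 2≤t ⟩
    t                           ∎
    where
    open ≤-Reasoning
    leaf : deg G v ≤ 1
    leaf = leafy u v (Adj-sym G (bit-positive 0<bit)) (<ᵇ⇒< t (deg G u) (subst T (sym high-u) _))

  edgeCount-≤-LeafNeighboursAbove : 2 ≤ t → LeafNeighboursAbove t G → 2 * edgeCount G ≤ n * t
  edgeCount-≤-LeafNeighboursAbove 2≤t leafy = begin
    2 * edgeCount G ≡⟨ handshake G ⟨
    sum (deg G)     ≡⟨ sum-deg≡sum-load ⟩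
    sum load        ≤⟨ sum-≤-* t (load-≤ 2≤t leafy) ⟩
    n * t           ∎
    where open ≤-Reasoning

P3Free⇒LeafNeighboursAbove2 : ∀ {n} (G : Graph n) → P3Free G → LeafNeighboursAbove 2 G
P3Free⇒LeafNeighboursAbove2 G free b c bc 2<deg-b with deg G c ≤? 1
... | yes deg-c≤1 = deg-c≤1
... | no  deg-c≰1
  with d , cd , d≢b ∷ [] ← neighbour-outside G c (b ∷ []) (≰⇒> deg-c≰1)
  with a , ba , a≢c ∷ a≢d ∷ [] ← neighbour-outside G b (c ∷ d ∷ []) 2<deg-b
  = contradiction (a , b , c , d , a≢b , a≢c , a≢d , Adj⇒≢ G bc , d≢b ∘ sym , Adj⇒≢ G cd , Adj-sym G ba , bc , cd) free
  where
  a≢b : a ≢ b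
  a≢b = Adj⇒≢ G (Adj-sym G ba)

RainbowP3Free⇒LeafNeighboursAbove3 : ∀ {n} (G : Graph n) → RainbowP3Free G → LeafNeighboursAbove 3 G
RainbowP3Free⇒LeafNeighboursAbove3 G (col , (col-sym , proper) , free) b c bc 3<deg-b with deg G c ≤? 1
... | yes deg-c≤1 = deg-c≤1
... | no  deg-c≰1
  with d , cd , d≢b ∷ [] ← neighbour-outside G c (b ∷ []) (≰⇒> deg-c≰1)
  with a₁ , ba₁ , a₁≢c ∷ a₁≢d ∷ [] ← neighbour-outside G b (c ∷ d ∷ []) (<-trans (n<1+n 2) 3<deg-b)
  with a₂ , ba₂ , a₂≢c ∷ a₂≢d ∷ a₂≢a₁ ∷ [] ← neighbour-outside G b (c ∷ d ∷ a₁ ∷ []) 3<deg-b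
  = contradiction (repeats-cd a₁ ba₁ a₁≢c a₁≢d) (λ eq → proper b a₁ a₂ ba₁ ba₂ (a₂≢a₁ ∘ sym) (trans eq (sym (repeats-cd a₂ ba₂ a₂≢c a₂≢d))))
  where
  col-bc≢col-cd : col b c ≢ col c d
  col-bc≢col-cd eq = proper c b d (Adj-sym G bc) cd (d≢b ∘ sym) (trans (col-sym c b (Adj-sym G bc)) eq)
  repeats-cd : ∀ a → Adj G b a → a ≢ c → a ≢ d → col b a ≡ col c d
  repeats-cd a ba a≢c a≢d with col b a ≟ℕ col c d
  ... | yes eq = eq
  ... | no  ne = contradiction
        ((a , b , c , d , (Adj⇒≢ G (Adj-sym G ba) , a≢c , a≢d , Adj⇒≢ G bc , d≢b ∘ sym , Adj⇒≢ G cd , Adj-sym G ba , bc , cd) ,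
          col-ab≢col-bc , (λ eq → ne (trans (col-sym b a ba) eq)) , col-bc≢col-cd))
        free
    where
    col-ab≢col-bc : col a b ≢ col b c
    col-ab≢col-bc eq = proper b a c ba bc a≢c (trans (col-sym b a ba) eq)

does-≟-sym : ∀ {n} (x y : Fin n) → does (x ≟ y) ≡ does (y ≟ x)
does-≟-sym x y with x ≟ y
... | yes refl = sym (dec-true (x ≟ x) refl)
... | no  x≢y  = sym (dec-false (y ≟ x) (x≢y ∘ sym))

-- Extremal graphs

-- The disjoint union of k copies of Kₘ: vertex i is vertex (slot i) of copy (block i).
module Cliques (k m : ℕ) where

  block : Fin (k * m) → Fin k
  block i = proj₁ (remQuot {k} m i)

  slot : Fin (k * m) → Fin m
  slot i = proj₂ (remQuot {k} m i)

  block-slot-injective : ∀ {i j} → block i ≡ block j → slot i ≡ slot j → i ≡ j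
  block-slot-injective {i} {j} bi≡bj si≡sj =
    trans (sym (combine-remQuot {k} m i)) (trans (cong₂ combine bi≡bj si≡sj) (combine-remQuot {k} m j))

  graph : Graph (k * m)
  graph = record
    { adj    = λ i j → does (block i ≟ block j) ∧ not (does (i ≟ j))
    ; sym    = λ i j → cong₂ (λ b c → b ∧ not c) (does-≟-sym (block i) (block j)) (does-≟-sym i j)
    ; irrefl = λ i → trans (cong (λ c → does (block i ≟ block i) ∧ not c) (dec-true (i ≟ i) refl)) (∧-zeroʳ _)
    }

  Adj⁺ : ∀ {i j} → block i ≡ block j → i ≢ j → Adj graph i j
  Adj⁺ {i} {j} bi≡bj i≢j =
    cong₂ (λ b c → b ∧ not c) (dec-true (block i ≟ block j) bi≡bj) (dec-false (i ≟ j) i≢j)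

  Adj⁻ : ∀ {i j} → Adj graph i j → block i ≡ block j
  Adj⁻ {i} {j} ij with block i ≟ block j
  ... | yes bi≡bj = bi≡bj

  slot-≢ : ∀ {i j} → block i ≡ block j → i ≢ j → slot i ≢ slot j
  slot-≢ bi≡bj i≢j si≡sj = i≢j (block-slot-injective bi≡bj si≡sj)

cliques-deg : ∀ k m i → m ≤ deg (Cliques.graph k (suc m)) i
cliques-deg k m i = injection-≤-sum (bit ∘ adj graph i) mate mate-injective
  (λ s → ≤-reflexive (sym (cong bit (i~mate s))))
  where
  open Cliques k (suc m)
  mate : Fin m → Fin (k * suc m)
  mate s = combine (block i) (punchIn (slot i) s)
  mate-injective : Injective _≡_ _≡_ mate
  mate-injective eq = punchIn-injective (slot i) _ _ (combine-injectiveʳ (block i) _ (block i) _ eq)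
  i~mate : ∀ s → Adj graph i (mate s)
  i~mate s = Adj⁺ (sym (cong proj₁ (remQuot-combine (block i) (punchIn (slot i) s))))
    λ i≡mate → punchInᵢ≢i (slot i) s (sym (trans (cong slot i≡mate) (cong proj₂ (remQuot-combine (block i) (punchIn (slot i) s)))))

cliques-edgeCount-≥ : ∀ k m → (k * suc m) * m ≤ 2 * edgeCount (Cliques.graph k (suc m))
cliques-edgeCount-≥ k m =
  subst ((k * suc m) * m ≤_) (handshake (Cliques.graph k (suc m))) (*-≤-sum m (cliques-deg k m))

klein : Fin 4 → Fin 4 → Fin 4
klein 0F b  = b
klein 1F 0F = 1F
klein 1F 1F = 0F
klein 1F 2F = 3F
klein 1F 3F = 2F
klein 2F 0F = 2F
klein 2F 1F = 3F
klein 2F 2F = 0F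
klein 2F 3F = 1F
klein 3F 0F = 3F
klein 3F 1F = 2F
klein 3F 2F = 1F
klein 3F 3F = 0F

klein-comm : ∀ a b → klein a b ≡ klein b a
klein-comm = from-yes (all? λ a → all? λ b → klein a b ≟ klein b a)

klein-cancelˡ : ∀ a b c → klein a b ≡ klein a c → b ≡ c
klein-cancelˡ = from-yes (all? λ a → all? λ b → all? λ c → klein a b ≟ klein a c →-dec b ≟ c)

klein-complement : ∀ a b c d → a ≢ b → a ≢ c → a ≢ d → b ≢ c → b ≢ d → c ≢ d →
                   klein a b ≡ klein c d
klein-complement = from-yes (all? λ a → all? λ b → all? λ c → all? λ d →
  ¬? (a ≟ b) →-dec ¬? (a ≟ c) →-dec ¬? (a ≟ d) →-dec ¬? (b ≟ c) →-dec ¬? (b ≟ d) →-dec ¬? (c ≟ d) →-dec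
  klein a b ≟ klein c d)

K₄s-RainbowP3Free : ∀ k → RainbowP3Free (Cliques.graph k 4)
K₄s-RainbowP3Free k = colour , (colour-sym , colour-proper) , no-rainbow
  where
  open Cliques k 4
  colour : Colouring (k * 4)
  colour i j = toℕ (klein (slot i) (slot j))
  colour-sym : ∀ u v → Adj graph u v → colour u v ≡ colour v u
  colour-sym u v _ = cong toℕ (klein-comm (slot u) (slot v))
  colour-proper : ∀ u v w → Adj graph u v → Adj graph u w → v ≢ w → colour u v ≢ colour u w
  colour-proper u v w uv uw v≢w eq =
    slot-≢ (trans (sym (Adj⁻ uv)) (Adj⁻ uw)) v≢w (klein-cancelˡ (slot u) (slot v) (slot w) (toℕ-injective eq))
  no-rainbow : ContainsRainbowP3 graph colour → ⊥
  no-rainbow (a , b , c , d , (a≢b , a≢c , a≢d , b≢c , b≢d , c≢d , ab , bc , cd) , _ , col-ab≢col-cd , _) =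
    col-ab≢col-cd (cong toℕ (klein-complement (slot a) (slot b) (slot c) (slot d)
      (slot-≢ ba≡bb a≢b) (slot-≢ ba≡bc a≢c) (slot-≢ (trans ba≡bc bc≡bd) a≢d)
      (slot-≢ bb≡bc b≢c) (slot-≢ (trans bb≡bc bc≡bd) b≢d) (slot-≢ bc≡bd c≢d)))
    where
    ba≡bb : block a ≡ block b
    ba≡bb = Adj⁻ ab
    bb≡bc : block b ≡ block c
    bb≡bc = Adj⁻ bc
    bc≡bd : block c ≡ block d
    bc≡bd = Adj⁻ cd
    ba≡bc : block a ≡ block c
    ba≡bc = trans ba≡bb bb≡bc

isCentre : ∀ {n} → Fin (suc n) → Bool
isCentre zero    = true
isCentre (suc _) = false

star : ∀ n → Graph (suc n)
star n = record
  { adj    = λ i j → isCentre i xor isCentre j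
  ; sym    = λ i j → xor-comm (isCentre i) (isCentre j)
  ; irrefl = λ i → xor-same (isCentre i)
  }

star-P3Free : ∀ n → P3Free (star n)
star-P3Free n (a , b , c , d , a≢b , a≢c , _ , b≢c , b≢d , _ , ab , bc , cd) = path a b c d a≢b a≢c b≢c b≢d ab bc cd
  where
  -- b or c is the centre, which forces a or d to be the centre as well.
  path : ∀ a b c d → a ≢ b → a ≢ c → b ≢ c → b ≢ d → Adj (star n) a b → Adj (star n) b c → Adj (star n) c d → ⊥
  path zero    zero    _       _       a≢b _   _   _   _ _ _ = a≢b refl
  path (suc _) zero    zero    _       _   _   b≢c _   _ _ _ = b≢c refl
  path (suc _) zero    (suc _) zero    _   _   _   b≢d _ _ _ = b≢d refl
  path zero    (suc _) zero    _       _   a≢c _   _   _ _ _ = a≢c refl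
  path _       (suc _) (suc _) _       _   _   _   _   _ () _
  path (suc _) (suc _) _       _       _   _   _   _   () _ _
  path (suc _) zero    (suc _) (suc _) _   _   _   _   _ _ ()

star-edgeCount : ∀ n → n ≤ edgeCount (star n)
star-edgeCount n = *-cancelˡ-≤ 2 (begin
  2 * n                                        ≡⟨ cong (n +_) (+-identityʳ n) ⟩
  n + n                                        ≡⟨ cong₂ _+_ (*-identityʳ n) (*-identityʳ n) ⟨
  n * 1 + n * 1                                ≤⟨ +-mono-≤ (*-≤-sum {n} 1 {λ _ → 1} (λ _ → ≤-refl)) (*-≤-sum {n} 1 {deg (star n) ∘ suc} λ _ → s≤s z≤n) ⟩
  deg (star n) zero + sum (deg (star n) ∘ suc) ≡⟨ handshake (star n) ⟩
  2 * edgeCount (star n)                       ∎)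
  where open ≤-Reasoning

IsMaxEdges-unique : ∀ {P : ∀ {n} → Graph n → Set} {n a b} → IsMaxEdges P n a → IsMaxEdges P n b → a ≡ b
IsMaxEdges-unique ((G , PG , eG≡a) , a-max) ((H , PH , eH≡b) , b-max) =
  ≤-antisym (subst (_≤ _) eG≡a (b-max G PG)) (subst (_≤ _) eH≡b (a-max H PH))

RainbowP3Free-edgeCount : ∀ {n} (G : Graph n) → RainbowP3Free G → 2 * edgeCount G ≤ n * 3
RainbowP3Free-edgeCount G rf =
  edgeCount-≤-LeafNeighboursAbove G 3 (s≤s (s≤s z≤n)) (RainbowP3Free⇒LeafNeighboursAbove3 G rf)

P3Free-edgeCount : ∀ {n} (G : Graph n) → P3Free G → edgeCount G ≤ n
P3Free-edgeCount {n} G free = *-cancelˡ-≤ 2 (begin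
  2 * edgeCount G ≤⟨ edgeCount-≤-LeafNeighboursAbove G 2 ≤-refl (P3Free⇒LeafNeighboursAbove2 G free) ⟩
  n * 2           ≡⟨ *-comm n 2 ⟩
  2 * n           ∎)
  where open ≤-Reasoning

K₄s-edgeCount : ∀ k → 2 * edgeCount (Cliques.graph k 4) ≡ 3 * (k * 4)
K₄s-edgeCount k = trans (≤-antisym (RainbowP3Free-edgeCount (Cliques.graph k 4) (K₄s-RainbowP3Free k)) (cliques-edgeCount-≥ k 3))
                        (*-comm (k * 4) 3)

K₄s-IsExStar : ∀ k → IsExStar (k * 4) (edgeCount (Cliques.graph k 4))
K₄s-IsExStar k = (Cliques.graph k 4 , K₄s-RainbowP3Free k , refl) , λ G rf →
  *-cancelˡ-≤ 2 (≤-trans (RainbowP3Free-edgeCount G rf) (≤-reflexive (trans (*-comm (k * 4) 3) (sym (K₄s-edgeCount k)))))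

IsExStar-double : ∀ n → 4 ∣ n → ∀ {e*} → IsExStar n e* → 2 * e* ≡ 3 * n
IsExStar-double .(k * 4) (divides k refl) isExStar =
  trans (cong (2 *_) (IsMaxEdges-unique {RainbowP3Free} isExStar (K₄s-IsExStar k))) (K₄s-edgeCount k)

IsExStar-value : ∀ n → 4 ∣ n → IsExStar n ((3 * n) / 2)
IsExStar-value .(k * 4) (divides k refl) = subst (IsExStar (k * 4)) e≡3n/2 (K₄s-IsExStar k)
  where
  e : ℕ
  e = edgeCount (Cliques.graph k 4)
  e≡3n/2 : e ≡ (3 * (k * 4)) / 2
  e≡3n/2 = sym (trans (cong (_/ 2) (trans (sym (K₄s-edgeCount k)) (*-comm 2 e))) (m*n/n≡m e 2))

IsEx-≤ : ∀ {n e} → IsEx n e → e ≤ n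
IsEx-≤ {n} ((G , free , eG≡e) , _) = subst (_≤ n) eG≡e (P3Free-edgeCount G free)

IsEx-≥ : ∀ n {e} → IsEx n e → n ≤ suc e
IsEx-≥ zero    _           = z≤n
IsEx-≥ (suc m) (_ , e-max) = s≤s (≤-trans (star-edgeCount m) (e-max (star m) (star-P3Free m)))

IsExStar-vs-IsEx : ∀ n → 4 ∣ n → ∀ {e* e} → IsExStar n e* → IsEx n e →
                   (2 * e* ≤ 3 * e + 3) × (3 * e ≤ 2 * e* + 3)
IsExStar-vs-IsEx n 4∣n {e*} {e} isExStar isEx =
  (begin
    2 * e*    ≡⟨ IsExStar-double n 4∣n isExStar ⟩
    3 * n     ≤⟨ *-monoʳ-≤ 3 (IsEx-≥ n isEx) ⟩
    3 * suc e ≡⟨ *-suc 3 e ⟩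
    3 + 3 * e ≡⟨ +-comm 3 (3 * e) ⟩
    3 * e + 3 ∎) ,
  (begin
    3 * e      ≤⟨ *-monoʳ-≤ 3 (IsEx-≤ isEx) ⟩
    3 * n      ≡⟨ IsExStar-double n 4∣n isExStar ⟨
    2 * e*     ≤⟨ m≤m+n (2 * e*) 3 ⟩
    2 * e* + 3 ∎)
  where open ≤-Reasoning

theorem10 : (∀ n → 4 ∣ n → IsExStar n ((3 * n) / 2)) ×
    (Σ ℕ λ C → ∀ n → 4 ∣ n → ∀ e* e → IsExStar n e* → IsEx n e →
    (2 * e* ≤ 3 * e + C) × (3 * e ≤ 2 * e* + C))
theorem10 = IsExStar-value , 3 , λ n 4∣n _ _ → IsExStar-vs-IsEx n 4∣n
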